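{- Let $\mu\in\mathcal H$ with $\Re(\mu)=0$ and $m=N(\mu)$ squarefree, and let $r=1$ if $m\not\equiv 3\pmod 4$, $r=2$ if $m\equiv 3\pmod 4$. If the ideal $\mathfrak a=R_\mu(\rho)$ of $\mathcal O(\mu)$ with right pseudo generator $\rho$ is ambiguous, i.e. $\mathfrak a=\overline{\mathfrak a}$, then $\rho$ divides $(2/r)\mu$ from the right, i.e. $(2/r)\mu\rho^{ -1}\in\mathcal H$.
   Context: Quaternions $q=t+xi+yj+zk$ with Hamilton's multiplication; $\Re(q)=t$, $\overline q=t-xi-yj-zk$, $N(q)=t^2+x^2+y^2+z^2$, $q^{ -1}=\overline q/N(q)$. $\mathcal H$ is the ring of Hurwitz integral quaternions $(a+bi+cj+dk)/2$ with $a,b,c,d\in\mathbb Z$ all of the same parity. $s$ divides $q$ from the right if $q=\xi s$ with $\xi\in\mathcal H$; $\gcd_r(q,s)$ is a common right divisor of maximal norm. With $\omega=(r-1+\mu)/r$, $\mathcal O(\mu)=\mathbb Z+\mathbb Z\omega$ is a commutative subring of $\mathcal H$. Every nonzero ideal of $\mathcal O(\mu)$ has $\mathbb Z$-basis $c[a,b+\omega]$ ($c,a>0$, primitive if $c=1$); its right pseudo generator is $c\cdot\gcd_r(a,b+\omega)$ (unique up to a unit on the left), and $R_\mu(\rho)=\{\xi\rho:\xi\in\mathcal H,\ \xi\rho\in\mathcal O(\mu)\}$ is the ideal with right pseudo generator $\rho$. The conjugate of an ideal is $\overline{\mathfrak a}=\{\overline x:x\in\mathfrak a\}$.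
   Formalization: The ideal 𝔞 is primitive: ρ is the right pseudo generator $\gcd_r(a,b+\omega)$ of an ideal of $\mathcal O(\mu)$ with $\mathbb Z$-basis $[a,b+\omega]$, so c = 1. The statement above fails without it. -}

module Defs where

open import Data.Nat as ℕ using (ℕ; _%_)
open import Data.Bool using (if_then_else_)
open import Data.Integer as ℤ using (ℤ; +_; _+_; _-_; _*_; -_; _≤_)
open import Data.Integer.Divisibility as ℤD using ()
open import Data.Product using (Σ; ∃; ∃-syntax; _×_)
open import Relation.Binary.PropositionalEquality using (_≡_)

-- Quaternions with half-integer coordinates, stored in DOUBLED form:
-- the record ⟨ a , b , c , d ⟩ denotes q = (a + b i + c j + d k) / 2.
-- Every Hurwitz quaternion (and every element of O(μ) ⊆ H) has such a
-- representation, and it is unique.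

record Q : Set where
  constructor ⟨_,_,_,_⟩
  field
    a b c d : ℤ
open Q public

Hurwitz : Q → Set
Hurwitz q = (+ 2 ℤD.∣ (a q - b q)) × (+ 2 ℤD.∣ (a q - c q)) × (+ 2 ℤD.∣ (a q - d q))

ham : Q → Q → Q
ham ⟨ a₁ , b₁ , c₁ , d₁ ⟩ ⟨ a₂ , b₂ , c₂ , d₂ ⟩ =
  ⟨ a₁ * a₂ - b₁ * b₂ - c₁ * c₂ - d₁ * d₂
  , a₁ * b₂ + b₁ * a₂ + c₁ * d₂ - d₁ * c₂
  , a₁ * c₂ - b₁ * d₂ + c₁ * a₂ + d₁ * b₂
  , a₁ * d₂ + b₁ * c₂ - c₁ * b₂ + d₁ * a₂ ⟩

scale : ℤ → Q → Q
scale n ⟨ a , b , c , d ⟩ = ⟨ n * a , n * b , n * c , n * d ⟩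

-- Mul x y z  :⇔  x · y = z  (as quaternions).
-- In doubled coordinates: (2x)(2y) = 4z, i.e. ham x y = 2·z.
Mul : Q → Q → Q → Set
Mul x y z = ham x y ≡ scale (+ 2) z

conj : Q → Q
conj ⟨ a , b , c , d ⟩ = ⟨ a , - b , - c , - d ⟩

-- 4·N(q)  (N(q) = t²+x²+y²+z² with t = a/2 etc.)
norm4 : Q → ℤ
norm4 ⟨ a , b , c , d ⟩ = a * a + b * b + c * c + d * d

ReZero : Q → Set
ReZero q = a q ≡ + 0

intQ : ℤ → Q
intQ n = ⟨ + 2 * n , + 0 , + 0 , + 0 ⟩

_∣ᵣ_ : Q → Q → Set
s ∣ᵣ q = ∃[ ξ ] (Hurwitz ξ × Mul ξ s q)

SquareFree : ℕ → Set
SquareFree m = ∀ (d : ℕ) → (d ℕ.* d) Data.Nat.Divisibility.∣ m → d ≡ 1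
  where import Data.Nat.Divisibility

rOf : ℕ → ℕ
rOf m = if (m % 4) ℕ.≡ᵇ 3 then 2 else 1

twoOverR : ℕ → ℕ
twoOverR m = if (m % 4) ℕ.≡ᵇ 3 then 1 else 2

-- The order O(μ) = ℤ + ℤω with ω = (r - 1 + μ)/r, r = rOf m.
-- OElem μ m u v x  :⇔  x = u + v ω.
-- Multiplying by r and doubling: r·(2x) = 2ru + 2(r-1)v + v·(2μ).
OElem : Q → ℕ → ℤ → ℤ → Q → Set
OElem μ m u v x =
  scale (+ rOf m) x ≡
    ⟨ + 2 * + rOf m * u + + 2 * (+ rOf m - + 1) * v + v * a μ
    , v * b μ , v * c μ , v * d μ ⟩

InO : Q → ℕ → Q → Set
InO μ m x = ∃[ u ] ∃[ v ] OElem μ m u v x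

InR : Q → ℕ → Q → Q → Set
InR μ m ρ x = (ρ ∣ᵣ x) × InO μ m x

InRConj : Q → ℕ → Q → Q → Set
InRConj μ m ρ x = ∃[ y ] (InR μ m ρ y × x ≡ conj y)

Ambiguous : Q → ℕ → Q → Set
Ambiguous μ m ρ = ∀ (x : Q) → (InR μ m ρ x → InRConj μ m ρ x) × (InRConj μ m ρ x → InR μ m ρ x)

InLat : Q → ℕ → ℤ → ℤ → Q → Set
InLat μ m a′ b′ x = ∃[ y ] ∃[ z ] OElem μ m (y * a′ + z * b′) z x

IsIdealLat : Q → ℕ → ℤ → ℤ → Set
IsIdealLat μ m a′ b′ =
  ∀ (o x p : Q) → InO μ m o → InLat μ m a′ b′ x → Mul o x p → InLat μ m a′ b′ p

IsGcdR : Q → Q → Q → Set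
IsGcdR α β ρ =
  Hurwitz ρ × (ρ ∣ᵣ α) × (ρ ∣ᵣ β) ×
  (∀ (s : Q) → Hurwitz s → s ∣ᵣ α → s ∣ᵣ β → norm4 s ≤ norm4 ρ)

PrimPseudoGen : Q → ℕ → Q → Set
PrimPseudoGen μ m ρ =
  ∃[ a′ ] ∃[ b′ ] ∃[ β ]
    ((+ 0 ℤ.< a′) × IsIdealLat μ m a′ b′ × OElem μ m b′ (+ 1) β × IsGcdR (intQ a′) β ρ)

{-# OPTIONS --safe #-}
module Submission where

-- Let β = b′ + ω be the second basis vector of the primitive ideal 𝔞 = [a′, b′ + ω].
-- Since ρ = gcd_r(a′, β), it divides β, so β ∈ 𝔞. Ambiguity gives β̄ ∈ 𝔞, so ρ also
-- divides β̄ from the right, hence divides β − β̄ = 2 Im(ω) = (2/r) μ.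

open import Defs
open import Data.Nat using (ℕ)
open import Data.Integer using (+_)
open import Relation.Binary.PropositionalEquality using (_≡_)

import Data.Nat as ℕ
open import Data.Bool using (true; false)
open import Data.Integer as ℤ using (ℤ; _+_; _-_; _*_; -_)
import Data.Integer.Divisibility as ℤD
open import Data.Integer.Divisibility.Signed using (∣ᵤ⇒∣; ∣⇒∣ᵤ; ∣m∣n⇒∣m-n)
open import Data.Integer.Properties using (*-assoc; *-identityʳ; neg-involutive; pos-*)
open import Data.Integer.Tactic.RingSolver using (solve-∀)
open import Data.Product using (_,_; proj₁)
open import Relation.Binary.PropositionalEquality
  using (refl; sym; trans; cong; cong₂; subst; module ≡-Reasoning)

infixl 6 _⊖_

_⊖_ : Q → Q → Q
x ⊖ y = ⟨ a x - a y , b x - b y , c x - c y , d x - d y ⟩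

cong-⟨⟩ : ∀ {a₁ b₁ c₁ d₁ a₂ b₂ c₂ d₂ : ℤ} →
          a₁ ≡ a₂ → b₁ ≡ b₂ → c₁ ≡ c₂ → d₁ ≡ d₂ →
          ⟨ a₁ , b₁ , c₁ , d₁ ⟩ ≡ ⟨ a₂ , b₂ , c₂ , d₂ ⟩
cong-⟨⟩ refl refl refl refl = refl

conj-involutive : ∀ x → conj (conj x) ≡ x
conj-involutive ⟨ a , b , c , d ⟩ =
  cong-⟨⟩ refl (neg-involutive b) (neg-involutive c) (neg-involutive d)

scale-distrib-⊖ : ∀ n x y → scale n x ⊖ scale n y ≡ scale n (x ⊖ y)
scale-distrib-⊖ n ⟨ a₁ , b₁ , c₁ , d₁ ⟩ ⟨ a₂ , b₂ , c₂ , d₂ ⟩ =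
  cong-⟨⟩ (*-distribˡ-- n a₁ a₂) (*-distribˡ-- n b₁ b₂)
          (*-distribˡ-- n c₁ c₂) (*-distribˡ-- n d₁ d₂)
  where
  *-distribˡ-- : ∀ n u v → n * u - n * v ≡ n * (u - v)
  *-distribˡ-- = solve-∀

ham-distribʳ-⊖ : ∀ x y z → ham (x ⊖ y) z ≡ ham x z ⊖ ham y z
ham-distribʳ-⊖ ⟨ a₁ , b₁ , c₁ , d₁ ⟩ ⟨ a₂ , b₂ , c₂ , d₂ ⟩ ⟨ p , q , r , s ⟩ =
  cong-⟨⟩ (re a₁ b₁ c₁ d₁ a₂ b₂ c₂ d₂ p q r s) (i a₁ b₁ c₁ d₁ a₂ b₂ c₂ d₂ p q r s)
          (j a₁ b₁ c₁ d₁ a₂ b₂ c₂ d₂ p q r s) (k a₁ b₁ c₁ d₁ a₂ b₂ c₂ d₂ p q r s)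
  where
  re : ∀ a₁ b₁ c₁ d₁ a₂ b₂ c₂ d₂ p q r s →
    (a₁ - a₂) * p - (b₁ - b₂) * q - (c₁ - c₂) * r - (d₁ - d₂) * s
    ≡ (a₁ * p - b₁ * q - c₁ * r - d₁ * s) - (a₂ * p - b₂ * q - c₂ * r - d₂ * s)
  re = solve-∀
  i : ∀ a₁ b₁ c₁ d₁ a₂ b₂ c₂ d₂ p q r s →
    (a₁ - a₂) * q + (b₁ - b₂) * p + (c₁ - c₂) * s - (d₁ - d₂) * r
    ≡ (a₁ * q + b₁ * p + c₁ * s - d₁ * r) - (a₂ * q + b₂ * p + c₂ * s - d₂ * r)
  i = solve-∀
  j : ∀ a₁ b₁ c₁ d₁ a₂ b₂ c₂ d₂ p q r s →
    (a₁ - a₂) * r - (b₁ - b₂) * s + (c₁ - c₂) * p + (d₁ - d₂) * q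
    ≡ (a₁ * r - b₁ * s + c₁ * p + d₁ * q) - (a₂ * r - b₂ * s + c₂ * p + d₂ * q)
  j = solve-∀
  k : ∀ a₁ b₁ c₁ d₁ a₂ b₂ c₂ d₂ p q r s →
    (a₁ - a₂) * s + (b₁ - b₂) * r - (c₁ - c₂) * q + (d₁ - d₂) * p
    ≡ (a₁ * s + b₁ * r - c₁ * q + d₁ * p) - (a₂ * s + b₂ * r - c₂ * q + d₂ * p)
  k = solve-∀

Hurwitz-⊖ : ∀ x y → Hurwitz x → Hurwitz y → Hurwitz (x ⊖ y)
Hurwitz-⊖ x y (xab , xac , xad) (yab , yac , yad) =
  even-diff (a x) (b x) (a y) (b y) xab yab ,
  even-diff (a x) (c x) (a y) (c y) xac yac ,
  even-diff (a x) (d x) (a y) (d y) xad yad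
  where
  rearrange : ∀ u v u′ v′ → (u - v) - (u′ - v′) ≡ (u - u′) - (v - v′)
  rearrange = solve-∀
  even-diff : ∀ u v u′ v′ → + 2 ℤD.∣ u - v → + 2 ℤD.∣ u′ - v′ →
              + 2 ℤD.∣ (u - u′) - (v - v′)
  even-diff u v u′ v′ 2∣u-v 2∣u′-v′ =
    subst (+ 2 ℤD.∣_) (rearrange u v u′ v′)
      (∣⇒∣ᵤ (∣m∣n⇒∣m-n {+ 2} {u - v} {u′ - v′} (∣ᵤ⇒∣ 2∣u-v) (∣ᵤ⇒∣ 2∣u′-v′)))

∣ᵣ-⊖ : ∀ {s x y} → s ∣ᵣ x → s ∣ᵣ y → s ∣ᵣ (x ⊖ y)
∣ᵣ-⊖ {s} {x} {y} (ξ , ξ∈H , ξs≡x) (η , η∈H , ηs≡y) =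
  ξ ⊖ η , Hurwitz-⊖ ξ η ξ∈H η∈H , (begin
    ham (ξ ⊖ η) s                 ≡⟨ ham-distribʳ-⊖ ξ η s ⟩
    ham ξ s ⊖ ham η s             ≡⟨ cong₂ _⊖_ ξs≡x ηs≡y ⟩
    scale (+ 2) x ⊖ scale (+ 2) y ≡⟨ scale-distrib-⊖ (+ 2) x y ⟩
    scale (+ 2) (x ⊖ y)           ∎)
  where open ≡-Reasoning

twoOverR*rOf≡2 : ∀ m → twoOverR m ℕ.* rOf m ≡ 2
twoOverR*rOf≡2 m with (m ℕ.% 4) ℕ.≡ᵇ 3
... | true  = refl
... | false = refl

-- x − x̄ = 2 Im x, while r · Im x = v · Im μ = v μ for x = u + v ω; and (2/r) · r = 2.
sub-conj-OElem : ∀ μ m u v x → ReZero μ → OElem μ m u v x →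
                 x ⊖ conj x ≡ scale (+ twoOverR m * v) μ
sub-conj-OElem ⟨ .(+ 0) , μ₁ , μ₂ , μ₃ ⟩ m u v ⟨ x₀ , x₁ , x₂ , x₃ ⟩ refl rx≡ =
  cong-⟨⟩ (real x₀ (+ twoOverR m * v))
          (imaginary x₁ μ₁ (cong b rx≡)) (imaginary x₂ μ₂ (cong c rx≡))
          (imaginary x₃ μ₃ (cong d rx≡))
  where
  t = + twoOverR m
  r = + rOf m

  real : ∀ x₀ w → x₀ - x₀ ≡ w * + 0
  real = solve-∀

  double : ∀ y → y - - y ≡ + 2 * y
  double = solve-∀

  imaginary : ∀ y μᵢ → r * y ≡ v * μᵢ → y - - y ≡ t * v * μᵢ
  imaginary y μᵢ ry≡vμᵢ = begin
    y - - y                      ≡⟨ double y ⟩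
    + 2 * y                      ≡⟨ cong (λ n → + n * y) (sym (twoOverR*rOf≡2 m)) ⟩
    + (twoOverR m ℕ.* rOf m) * y ≡⟨ cong (_* y) (pos-* (twoOverR m) (rOf m)) ⟩
    t * r * y                    ≡⟨ *-assoc t r y ⟩
    t * (r * y)                  ≡⟨ cong (t *_) ry≡vμᵢ ⟩
    t * (v * μᵢ)                 ≡⟨ sym (*-assoc t v μᵢ) ⟩
    t * v * μᵢ                   ∎
    where open ≡-Reasoning

theorem1 : (μ : Q) (m : ℕ) (ρ : Q)
    → Hurwitz μ → ReZero μ
    → norm4 μ ≡ + (4 Data.Nat.* m) → SquareFree m
    → PrimPseudoGen μ m ρ
    → Ambiguous μ m ρ
    → ρ ∣ᵣ scale (+ twoOverR m) μ
theorem1 μ m ρ _ Reμ≡0 _ _ (_ , b′ , β , _ , _ , β≡b′+ω , _ , _ , ρ∣β , _) ambiguous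
  with proj₁ (ambiguous β) (ρ∣β , b′ , + 1 , β≡b′+ω)
... | y , (ρ∣y , _) , β≡ȳ = subst (ρ ∣ᵣ_) β-y≡tμ (∣ᵣ-⊖ ρ∣β ρ∣y)
  where
  open ≡-Reasoning
  β̄≡y : conj β ≡ y
  β̄≡y = trans (cong conj β≡ȳ) (conj-involutive y)

  β-y≡tμ : β ⊖ y ≡ scale (+ twoOverR m) μ
  β-y≡tμ = begin
    β ⊖ y                            ≡⟨ cong (β ⊖_) (sym β̄≡y) ⟩
    β ⊖ conj β                       ≡⟨ sub-conj-OElem μ m b′ (+ 1) β Reμ≡0 β≡b′+ω ⟩
    scale (+ twoOverR m * + 1) μ     ≡⟨ cong (λ n → scale n μ) (*-identityʳ (+ twoOverR m)) ⟩
    scale (+ twoOverR m) μ           ∎
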